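{- Let $n, r$ be nonnegative integers with $n\geqslant\lceil r/2\rceil+2$. Then $m(L(K_n),r)\geqslant\lfloor (r+2)^2/8\rfloor$.
   Context: All graphs are finite, simple and undirected. For an integer $r\geqslant 0$ and a graph $G$, the $r$-neighbor bootstrap percolation process on $G$ starts with a set $A_0\subseteq V(G)$ of initially active vertices, and for $i\geqslant 1$, $A_i=A_{i-1}\cup\{v\in V(G): |N(v)\cap A_{i-1}|\geqslant r\}$, where $N(v)$ is the set of neighbors of $v$; $A_0$ is a percolating set if $\bigcup_{i\geqslant 0}A_i=V(G)$. $m(G,r)$ is the minimum size of a percolating set. The line graph $L(G)$ has vertex set $E(G)$, two vertices adjacent iff the corresponding edges share an endpoint. $K_n$ is the complete graph on $n$ vertices. -}

module Defs where

open import Data.Bool using (Bool; true; false; _∧_; _∨_; not)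
open import Data.Nat using (ℕ; zero; suc; _≤ᵇ_)
open import Data.Fin using (Fin; _<_; _<?_)
open import Data.Fin.Properties using () renaming (_≟_ to _≟ᶠ_)
open import Data.List using (List; []; _∷_; length; filterᵇ; mapMaybe; concatMap; allFin)
open import Data.Maybe using (Maybe; just; nothing)
open import Data.Product using (Σ; _×_; _,_; ∃)
open import Relation.Nullary using (yes; no)
open import Relation.Nullary.Decidable using (⌊_⌋)
open import Relation.Binary.PropositionalEquality using (_≡_)

-- A finite simple graph given by a type of vertices V, a list `verts`
-- enumerating every vertex exactly once, and a Boolean adjacency
-- relation (symmetric, irreflexive).

record FinGraph : Set₁ where
  field
    V     : Set
    verts : List V
    adj   : V → V → Bool

module _ (G : FinGraph) where
  open FinGraph G

  VSet : Set
  VSet = V → Bool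

  card : VSet → ℕ
  card S = length (filterᵇ S verts)

  nbrCount : VSet → V → ℕ
  nbrCount S v = length (filterᵇ (λ u → adj v u ∧ S u) verts)

  step : ℕ → VSet → VSet
  step r A v = A v ∨ (r ≤ᵇ nbrCount A v)

  iter : ℕ → ℕ → VSet → VSet
  iter r zero    A = A
  iter r (suc i) A = step r (iter r i A)

  -- A_0 percolates: ⋃_i A_i = V(G).  (The A_i are increasing, so this
  -- is equivalent to some A_i being all of V; we state the union form.)
  Percolating : ℕ → VSet → Set
  Percolating r A = (v : V) → ∃ λ i → iter r i A v ≡ true

-- The line graph L(K_n): vertices are edges {i,j} of K_n, represented
-- as pairs (i , j) with i < j; two are adjacent iff they are distinct
-- and share an endpoint.

EdgeKn : ℕ → Set
EdgeKn n = Σ (Fin n × Fin n) λ { (i , j) → i < j }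

edgesKn : (n : ℕ) → List (EdgeKn n)
edgesKn n = concatMap (λ i → mapMaybe (mk i) (allFin n)) (allFin n)
  where
  mk : Fin n → Fin n → Maybe (EdgeKn n)
  mk i j with i <? j
  ... | yes p = just ((i , j) , p)
  ... | no  _ = nothing

eqF : ∀ {n} → Fin n → Fin n → Bool
eqF a b = ⌊ a ≟ᶠ b ⌋

adjLKn : (n : ℕ) → EdgeKn n → EdgeKn n → Bool
adjLKn n ((i , j) , _) ((k , l) , _) =
  not (eqF i k ∧ eqF j l) ∧ (eqF i k ∨ eqF i l ∨ eqF j k ∨ eqF j l)

LK : ℕ → FinGraph
LK n = record { V = EdgeKn n ; verts = edgesKn n ; adj = adjLKn n }

-- Write E(K_W) for the edges of the complete graph on a vertex set W, and call A (a set of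
-- edges, i.e. of vertices of L(K_n)) "spreading with threshold s on W" when every nonempty set
-- X of uninfected edges of K_W contains an edge with at least s neighbours in E(K_W) \ X.
-- A percolating set is spreading with threshold r on all of V(K_n), since a set X violating
-- this would never be infected.  We then show, by induction on s in steps of 2 and 4, that
-- if A is spreading with threshold s on W and |W| ≥ ⌈s/2⌉ + 2, then |A ∩ E(K_W)| ≥ ⌊(s+2)²/8⌋:
--   * if all of E(K_W) is infected, a vertex x ∈ W carries |W| - 1 infected edges and A is
--     spreading with threshold s - 2 on W - x;
--   * otherwise an uninfected edge uv has s infected neighbours and A is spreading with
--     threshold s - 4 on W - u - v; the neighbours and E(K_{W-u-v}) are disjoint.

module Submission where

open import Defs
open import Data.Nat using (ℕ; _≤_; _≥_; _+_; _*_; _/_; ⌈_/2⌉)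
open import Data.Nat using (zero; suc; z≤n; s≤s; _≤ᵇ_)
open import Data.Nat.Properties
  using ( ≤-refl; ≤-reflexive; ≤-trans; ≤-pred; module ≤-Reasoning; _≤?_; ≤ᵇ⇒≤; <-irrelevant
        ; +-comm; +-assoc; *-identityˡ; *-identityʳ; +-mono-≤; +-monoˡ-≤; +-monoʳ-≤; *-monoʳ-≤
        ; +-cancelˡ-≤; m≤m+n; m≤n+m; ⌊n/2⌋+⌈n/2⌉≡n; ⌊n/2⌋≤⌈n/2⌉; +-*-semiring; +-commutativeSemigroup )
open import Data.Nat.DivMod using (+-distrib-/-∣ʳ; m*n/n≡m; /-monoˡ-≤)
open import Data.Nat.Divisibility using (divides)
open import Data.Nat.Tactic.RingSolver using (solve-∀)
open import Data.Bool using (Bool; true; false; _∧_; _∨_; not)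
open import Data.Bool.Properties using (∧-conicalˡ; ∧-conicalʳ; ∧-zeroʳ; ∨-assoc)
import Data.Bool.Properties as Boolₚ
open import Data.Fin using (Fin; zero; suc) renaming (_<_ to _<ᶠ_)
import Data.Fin.Properties as Finₚ
open import Data.List using (List; []; _∷_; length; filterᵇ; _++_; concatMap; mapMaybe; tabulate; allFin)
open import Data.List.Membership.Propositional using (_∈_; lose)
open import Data.List.Relation.Unary.Any using (any?; satisfied)
open import Data.List.Relation.Unary.Any.Properties using (concatMap⁺; mapMaybe⁺; map⁺; tabulate⁺)
open import Data.Maybe using (Maybe; just; nothing)
import Data.Maybe.Relation.Unary.Any as Maybe
open import Data.Product using (Σ; ∃; _×_; _,_; proj₁; proj₂)
open import Data.Sum using (_⊎_; inj₁; inj₂)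
open import Data.Empty using (⊥-elim)
open import Function using (_∘_; id)
open import Algebra.Properties.CommutativeSemigroup +-commutativeSemigroup using (interchange)
open import Algebra.Properties.Semiring.Sum +-*-semiring
  using (sum; ∑-distrib-+; sum-cong-≗; sum-replicate-zero; *-distribˡ-sum; *-distribʳ-sum)
open import Relation.Binary.Definitions using (tri<; tri≈; tri>)
open import Relation.Binary.PropositionalEquality
  using (_≡_; refl; sym; trans; cong; cong₂; subst; subst₂; module ≡-Reasoning)
open import Relation.Nullary using (¬_; Dec; does; yes; no)
open import Relation.Nullary.Decidable using (⌊⌋-map′; dec-true; dec-false; T?; _×-dec_)

bound : ℕ → ℕ
bound s = ((s + 2) * (s + 2)) / 8

bound-shift : ∀ s c → ((s + 2) * (s + 2) + c * 8) / 8 ≡ bound s + c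
bound-shift s c =
  trans (+-distrib-/-∣ʳ ((s + 2) * (s + 2)) (divides c refl)) (cong (bound s +_) (m*n/n≡m c 8))

-- For s ≤ 3 the bound is at most s, and s is at most 1 + ⌈s/2⌉ (small thresholds are
-- handled directly, without induction).
bound-small : ∀ s → s ≤ 3 → bound s ≤ s
bound-small 0 _ = z≤n
bound-small 1 _ = ≤-refl
bound-small 2 _ = ≤-refl
bound-small 3 _ = ≤-refl
bound-small (suc (suc (suc (suc _)))) (s≤s (s≤s (s≤s ())))

small-half : ∀ s → s ≤ 3 → s ≤ 1 + ⌈ s /2⌉
small-half 0 _ = z≤n
small-half 1 _ = s≤s z≤n
small-half 2 _ = ≤-refl
small-half 3 _ = ≤-refl
small-half (suc (suc (suc (suc _)))) (s≤s (s≤s (s≤s ())))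

-- Removing one vertex lowers the threshold by 2: (s+4)² = (s+2)² + 4s + 12 ≤ (s+2)² + 8(2+⌈s/2⌉).
bound-step2 : ∀ s → bound (2 + s) ≤ bound s + (2 + ⌈ s /2⌉)
bound-step2 s = begin
  bound (2 + s)                               ≡⟨ cong (_/ 8) (expand s) ⟩
  ((s + 2) * (s + 2) + (4 * s + 12)) / 8      ≤⟨ /-monoˡ-≤ 8 (+-monoʳ-≤ ((s + 2) * (s + 2)) linear) ⟩
  ((s + 2) * (s + 2) + (2 + ⌈ s /2⌉) * 8) / 8 ≡⟨ bound-shift s (2 + ⌈ s /2⌉) ⟩
  bound s + (2 + ⌈ s /2⌉)                     ∎
  where
  open ≤-Reasoning
  expand : ∀ s → (2 + s + 2) * (2 + s + 2) ≡ (s + 2) * (s + 2) + (4 * s + 12)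
  expand = solve-∀
  eight : ∀ c → (2 + c) * 8 ≡ 4 * (c + c) + 16
  eight = solve-∀
  s≤2⌈s/2⌉ : s ≤ ⌈ s /2⌉ + ⌈ s /2⌉
  s≤2⌈s/2⌉ = subst (_≤ ⌈ s /2⌉ + ⌈ s /2⌉) (⌊n/2⌋+⌈n/2⌉≡n s) (+-monoˡ-≤ ⌈ s /2⌉ (⌊n/2⌋≤⌈n/2⌉ s))
  linear : 4 * s + 12 ≤ (2 + ⌈ s /2⌉) * 8
  linear = subst (4 * s + 12 ≤_) (sym (eight ⌈ s /2⌉)) (+-mono-≤ (*-monoʳ-≤ 4 s≤2⌈s/2⌉) (m≤m+n 12 4))

-- Removing the two ends of an edge lowers the threshold by 4: (s+6)² = (s+2)² + 8(s+4).
bound-step4 : ∀ s → bound (4 + s) ≡ bound s + (4 + s)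
bound-step4 s = trans (cong (_/ 8) (expand s)) (bound-shift s (4 + s))
  where
  expand : ∀ s → (4 + s + 2) * (4 + s + 2) ≡ (s + 2) * (s + 2) + (4 + s) * 8
  expand = solve-∀

𝟙 : Bool → ℕ
𝟙 true  = 1
𝟙 false = 0

∧-intro : ∀ {a b} → a ≡ true → b ≡ true → a ∧ b ≡ true
∧-intro refl refl = refl

∨-introˡ : ∀ {a} b → a ≡ true → a ∨ b ≡ true
∨-introˡ _ refl = refl

∨-introʳ : ∀ a {b} → b ≡ true → a ∨ b ≡ true
∨-introʳ true  _ = refl
∨-introʳ false b = b

not-intro : ∀ {a} → a ≡ false → not a ≡ true
not-intro refl = refl

not-elim : ∀ {a} → not a ≡ true → a ≡ false
not-elim {false} _ = refl

does-true : ∀ {P : Set} (d : Dec P) → does d ≡ true → P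
does-true (yes p) _ = p

∨-true : ∀ {a b} → a ∨ b ≡ true → a ≡ true ⊎ b ≡ true
∨-true {true}  _ = inj₁ refl
∨-true {false} b = inj₂ b

𝟙-mono : ∀ {a b} → (a ≡ true → b ≡ true) → 𝟙 a ≤ 𝟙 b
𝟙-mono {false} _   = z≤n
𝟙-mono {true}  a⇒b rewrite a⇒b refl = ≤-refl

𝟙-*-≤ : ∀ {a b c} → (a ≡ true → b ≡ true → c ≡ true) → 𝟙 a * 𝟙 b ≤ 𝟙 c
𝟙-*-≤ {false}        _ = z≤n
𝟙-*-≤ {true} {false} _ = z≤n
𝟙-*-≤ {true} {true}  a∧b⇒c rewrite a∧b⇒c refl refl = ≤-refl

module _ {X : Set} where

  infixr 7 _∩_
  infixr 6 _∪_
  infix  4 _⊆_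

  _∩_ _∪_ : (X → Bool) → (X → Bool) → X → Bool
  (P ∩ Q) x = P x ∧ Q x
  (P ∪ Q) x = P x ∨ Q x

  ∁ : (X → Bool) → X → Bool
  ∁ P x = not (P x)

  _⊆_ : (X → Bool) → (X → Bool) → Set
  P ⊆ Q = ∀ x → P x ≡ true → Q x ≡ true

  -- Membership in an intersection (predicates explicit, since _∧_ cannot be inverted).
  ∩-elim : ∀ P Q x → (P ∩ Q) x ≡ true → P x ≡ true × Q x ≡ true
  ∩-elim P Q x h = ∧-conicalˡ (P x) (Q x) h , ∧-conicalʳ (P x) (Q x) h

  count : (X → Bool) → List X → ℕ
  count P xs = length (filterᵇ P xs)

  count-∷ : ∀ P x xs → count P (x ∷ xs) ≡ 𝟙 (P x) + count P xs
  count-∷ P x xs with P x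
  ... | true  = refl
  ... | false = refl

  count-mono : ∀ {P Q} → P ⊆ Q → ∀ xs → count P xs ≤ count Q xs
  count-mono P⊆Q [] = z≤n
  count-mono {P} {Q} P⊆Q (x ∷ xs) rewrite count-∷ P x xs | count-∷ Q x xs =
    +-mono-≤ (𝟙-mono (P⊆Q x)) (count-mono P⊆Q xs)

  count-≡-+ : ∀ {P Q R} → (∀ x → 𝟙 (P x) ≡ 𝟙 (Q x) + 𝟙 (R x)) →
              ∀ xs → count P xs ≡ count Q xs + count R xs
  count-≡-+ pw [] = refl
  count-≡-+ {P} {Q} {R} pw (x ∷ xs)
    rewrite count-∷ P x xs | count-∷ Q x xs | count-∷ R x xs | pw x | count-≡-+ pw xs =
    interchange (𝟙 (Q x)) (𝟙 (R x)) _ _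

  count-≤-+ : ∀ {P Q R} → (∀ x → 𝟙 (P x) ≤ 𝟙 (Q x) + 𝟙 (R x)) →
              ∀ xs → count P xs ≤ count Q xs + count R xs
  count-≤-+ pw [] = z≤n
  count-≤-+ {P} {Q} {R} pw (x ∷ xs)
    rewrite count-∷ P x xs | count-∷ Q x xs | count-∷ R x xs =
    ≤-trans (+-mono-≤ (pw x) (count-≤-+ pw xs)) (≤-reflexive (interchange (𝟙 (Q x)) (𝟙 (R x)) _ _))

  count-split : ∀ P Q xs → count P xs ≡ count (P ∩ Q) xs + count (P ∩ ∁ Q) xs
  count-split P Q = count-≡-+ λ x → split (P x) (Q x)
    where
    split : ∀ a b → 𝟙 a ≡ 𝟙 (a ∧ b) + 𝟙 (a ∧ not b)
    split false _     = refl
    split true  true  = refl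
    split true  false = refl

  count-∪ : ∀ P Q xs → count (P ∪ Q) xs ≤ count P xs + count Q xs
  count-∪ P Q = count-≤-+ λ x → union (P x) (Q x)
    where
    union : ∀ a b → 𝟙 (a ∨ b) ≤ 𝟙 a + 𝟙 b
    union false _ = ≤-refl
    union true  _ = s≤s z≤n

  count-++ : ∀ P xs ys → count P (xs ++ ys) ≡ count P xs + count P ys
  count-++ P [] ys = refl
  count-++ P (x ∷ xs) ys rewrite count-∷ P x (xs ++ ys) | count-∷ P x xs | count-++ P xs ys =
    sym (+-assoc (𝟙 (P x)) _ _)

sum-mono : ∀ {m} {f g : Fin m → ℕ} → (∀ i → f i ≤ g i) → sum f ≤ sum g
sum-mono {zero}  _   = z≤n
sum-mono {suc m} f≤g = +-mono-≤ (f≤g zero) (sum-mono (f≤g ∘ suc))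

eqF-true : ∀ {m} {x y : Fin m} → eqF x y ≡ true → x ≡ y
eqF-true {x = x} {y} with x Finₚ.≟ y
... | yes x≡y = λ _ → x≡y
... | no  _   = λ ()

eqF-false : ∀ {m} {x y : Fin m} → ¬ x ≡ y → eqF x y ≡ false
eqF-false {x = x} {y} x≢y with x Finₚ.≟ y
... | yes x≡y = ⊥-elim (x≢y x≡y)
... | no  _   = refl

eqF-refl : ∀ {m} (x : Fin m) → eqF x x ≡ true
eqF-refl x with x Finₚ.≟ x
... | yes _   = refl
... | no  x≢x = ⊥-elim (x≢x refl)

eqF-false⇒≢ : ∀ {m} {x y : Fin m} → eqF x y ≡ false → ¬ x ≡ y
eqF-false⇒≢ {x = x} x≉x refl = Boolₚ.not-¬ x≉x (eqF-refl x)

eqF-suc : ∀ {m} (x y : Fin m) → eqF (suc x) (suc y) ≡ eqF x y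
eqF-suc x y = ⌊⌋-map′ (cong suc) Finₚ.suc-injective (x Finₚ.≟ y)

sum-δ : ∀ {m} (x : Fin m) → sum (λ i → 𝟙 (eqF x i)) ≡ 1
sum-δ {suc m} zero    = cong suc (sum-replicate-zero m)
sum-δ {suc m} (suc x) = trans (sum-cong-≗ (λ i → cong 𝟙 (eqF-suc x i))) (sum-δ x)

sum-ones : ∀ m → sum {m} (λ _ → 1) ≡ m
sum-ones zero    = refl
sum-ones (suc m) = cong suc (sum-ones m)

sum-δ-row : ∀ {m} (x : Fin m) (f : Fin m → ℕ) → sum (λ i → sum (λ j → 𝟙 (eqF x i) * f j)) ≡ sum f
sum-δ-row x f = begin
  sum (λ i → sum (λ j → 𝟙 (eqF x i) * f j)) ≡⟨ sum-cong-≗ (λ i → sym (*-distribˡ-sum (𝟙 (eqF x i)) f)) ⟩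
  sum (λ i → 𝟙 (eqF x i) * sum f)           ≡⟨ sym (*-distribʳ-sum (sum f) (λ i → 𝟙 (eqF x i))) ⟩
  sum (λ i → 𝟙 (eqF x i)) * sum f           ≡⟨ cong (_* sum f) (sum-δ x) ⟩
  1 * sum f                                 ≡⟨ *-identityˡ (sum f) ⟩
  sum f                                     ∎
  where open ≡-Reasoning

sum-δ-col : ∀ {m} (x : Fin m) (f : Fin m → ℕ) → sum (λ i → sum (λ j → f i * 𝟙 (eqF x j))) ≡ sum f
sum-δ-col x f = sum-cong-≗ λ i →
  trans (sym (*-distribˡ-sum (f i) (λ j → 𝟙 (eqF x j)))) (trans (cong (f i *_) (sum-δ x)) (*-identityʳ (f i)))

sum-witness : ∀ {m} (W : Fin m → Bool) → 1 ≤ sum (𝟙 ∘ W) → ∃ λ i → W i ≡ true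
sum-witness {suc m} W pos with W zero in W0
... | true  = zero , W0
... | false = let (i , Wi) = sum-witness (W ∘ suc) pos in suc i , Wi

countMaybe : ∀ {X : Set} → (X → Bool) → Maybe X → ℕ
countMaybe P nothing  = 0
countMaybe P (just x) = 𝟙 (P x)

module _ {X Y : Set} (P : X → Bool) where

  count-concatMap : (g : Y → List X) {m : ℕ} (h : Fin m → Y) →
                    count P (concatMap g (tabulate h)) ≡ sum (λ i → count P (g (h i)))
  count-concatMap g {zero}  h = refl
  count-concatMap g {suc m} h =
    trans (count-++ P (g (h zero)) _) (cong (count P (g (h zero)) +_) (count-concatMap g (h ∘ suc)))

  count-mapMaybe : (g : Y → Maybe X) {m : ℕ} (h : Fin m → Y) →
                   count P (mapMaybe g (tabulate h)) ≡ sum (λ i → countMaybe P (g (h i)))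
  count-mapMaybe g {zero}  h = refl
  count-mapMaybe g {suc m} h with g (h zero)
  ... | nothing = count-mapMaybe g (h ∘ suc)
  ... | just x  = trans (count-∷ P x _) (cong (𝟙 (P x) +_) (count-mapMaybe g (h ∘ suc)))

module CompleteGraph (n : ℕ) where

  Edge : Set
  Edge = EdgeKn n

  edges : List Edge
  edges = edgesKn n

  adj : Edge → Edge → Bool
  adj = adjLKn n

  Vertices : Set
  Vertices = Fin n → Bool

  size : Vertices → ℕ
  size W = sum (𝟙 ∘ W)

  everything : Vertices
  everything _ = true

  _─_ : Vertices → Fin n → Vertices
  (W ─ x) i = W i ∧ not (eqF x i)

  has : Fin n → Edge → Bool
  has x ((i , j) , _) = eqF x i ∨ eqF x j

  inside : Vertices → Edge → Bool
  inside W ((i , j) , _) = W i ∧ W j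

  -- Defs.edgesKn maps a local function over all pairs (i , j); we name it mkEdge by unification.
  -- It yields the edge {i,j} exactly when i < j, as recorded by the view MkEdgeView.
  private
    enumeration : Σ (Fin n → Fin n → Maybe Edge) λ mk →
                  edges ≡ concatMap (λ i → mapMaybe (mk i) (allFin n)) (allFin n)
    enumeration = _ , refl

  mkEdge : Fin n → Fin n → Maybe Edge
  mkEdge = proj₁ enumeration

  data MkEdgeView (i j : Fin n) : Maybe Edge → Set where
    ordered   : (p : i <ᶠ j) → MkEdgeView i j (just ((i , j) , p))
    unordered : ¬ i <ᶠ j → MkEdgeView i j nothing

  mkEdge-view : ∀ i j → MkEdgeView i j (mkEdge i j)
  mkEdge-view i j with i Finₚ.<? j
  ... | yes p = ordered p
  ... | no ¬p = unordered ¬p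

  every-edge-listed : ∀ e → e ∈ edges
  every-edge-listed e@((i , j) , p) =
    concatMap⁺ (λ i → mapMaybe (mkEdge i) (allFin n))
      (tabulate⁺ i (mapMaybe⁺ (mkEdge i) (allFin n) (map⁺ (tabulate⁺ j found))))
    where
    found : Maybe.Any (e ≡_) (mkEdge i j)
    found with mkEdge i j | mkEdge-view i j
    ... | _ | ordered q   = Maybe.just (cong ((i , j) ,_) (<-irrelevant p q))
    ... | _ | unordered ¬p = ⊥-elim (¬p p)

  count-pairs : ∀ P → count P edges ≡ sum (λ i → sum (λ j → countMaybe P (mkEdge i j)))
  count-pairs P = trans (count-concatMap P (λ i → mapMaybe (mkEdge i) (allFin n)) id)
                        (sum-cong-≗ λ i → count-mapMaybe P (mkEdge i) id)

  count-single : ∀ P (e₀ : Edge) → (∀ e → P e ≡ true → e ≡ e₀) → count P edges ≤ 1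
  count-single P ((a , b) , _) only = begin
    count P edges                                            ≡⟨ count-pairs P ⟩
    sum (λ i → sum (λ j → countMaybe P (mkEdge i j)))        ≤⟨ sum-mono (λ i → sum-mono (λ j → at-ab i j)) ⟩
    sum (λ i → sum (λ j → 𝟙 (eqF a i) * 𝟙 (eqF b j)))        ≡⟨ sum-δ-row a (λ j → 𝟙 (eqF b j)) ⟩
    sum (λ j → 𝟙 (eqF b j))                                  ≡⟨ sum-δ b ⟩
    1                                                        ∎
    where
    open ≤-Reasoning
    at-ab : ∀ i j → countMaybe P (mkEdge i j) ≤ 𝟙 (eqF a i) * 𝟙 (eqF b j)
    at-ab i j with mkEdge i j | mkEdge-view i j
    ... | _ | unordered _ = z≤n
    ... | _ | ordered q with P ((i , j) , q) in Pe
    ...   | false = z≤n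
    ...   | true with only _ Pe
    ...     | refl rewrite eqF-refl a | eqF-refl b = ≤-refl

  endpoints-determine-edge : ∀ a b (p : a <ᶠ b) e → has a e ≡ true → has b e ≡ true → e ≡ ((a , b) , p)
  endpoints-determine-edge a b p ((i , j) , q) ha hb with ∨-true ha | ∨-true hb
  ... | inj₁ a≡i | inj₁ b≡i = ⊥-elim (Finₚ.<-irrefl (trans (eqF-true a≡i) (sym (eqF-true b≡i))) p)
  ... | inj₂ a≡j | inj₂ b≡j = ⊥-elim (Finₚ.<-irrefl (trans (eqF-true a≡j) (sym (eqF-true b≡j))) p)
  ... | inj₁ a≡i | inj₂ b≡j with eqF-true a≡i | eqF-true b≡j
  ...   | refl | refl = cong ((a , b) ,_) (<-irrelevant q p)
  endpoints-determine-edge a b p ((i , j) , q) ha hb | inj₂ a≡j | inj₁ b≡i with eqF-true a≡j | eqF-true b≡i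
  ...   | refl | refl = ⊥-elim (Finₚ.<-asym p q)

  common-edge : ∀ u x → ¬ x ≡ u → count (has u ∩ has x) edges ≤ 1
  common-edge u x x≢u with Finₚ.<-cmp u x
  ... | tri< u<x _ _ = count-single _ ((u , x) , u<x) λ e h →
          endpoints-determine-edge u x u<x e (∧-conicalˡ _ _ h) (∧-conicalʳ _ _ h)
  ... | tri≈ _ u≡x _ = ⊥-elim (x≢u (sym u≡x))
  ... | tri> _ _ x<u = count-single _ ((x , u) , x<u) λ e h →
          endpoints-determine-edge x u x<u e (∧-conicalʳ _ _ h) (∧-conicalˡ _ _ h)

  starts-at : Fin n → Edge → Bool
  starts-at x ((i , _) , _) = eqF x i

  above below : Vertices → Fin n → Vertices
  above W x j = W j ∧ does (x Finₚ.<? j)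
  below W x i = W i ∧ does (i Finₚ.<? x)

  size-around : ∀ W x → size W ≤ size (above W x) + size (below W x) + 1
  size-around W x = begin
    size W                                                        ≤⟨ sum-mono trichotomy ⟩
    sum (λ j → 𝟙 (above W x j) + 𝟙 (below W x j) + 𝟙 (eqF x j)) ≡⟨ ∑-distrib-+ (λ j → 𝟙 (above W x j) + 𝟙 (below W x j)) _ ⟩
    sum (λ j → 𝟙 (above W x j) + 𝟙 (below W x j)) + sum (λ j → 𝟙 (eqF x j))
                                                                  ≡⟨ cong₂ _+_ (∑-distrib-+ (𝟙 ∘ above W x) _) (sum-δ x) ⟩
    size (above W x) + size (below W x) + 1                       ∎
    where
    open ≤-Reasoning
    trichotomy : ∀ j → 𝟙 (W j) ≤ 𝟙 (above W x j) + 𝟙 (below W x j) + 𝟙 (eqF x j)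
    trichotomy j with Finₚ.<-cmp x j
    ... | tri< x<j _ _ = ≤-trans (𝟙-mono (λ Wj → ∧-intro Wj (dec-true (x Finₚ.<? j) x<j)))
                                 (≤-trans (m≤m+n _ (𝟙 (below W x j))) (m≤m+n _ _))
    ... | tri≈ _ refl _ = ≤-trans (𝟙-mono (λ _ → eqF-refl x)) (m≤n+m _ _)
    ... | tri> _ _ j<x = ≤-trans (𝟙-mono (λ Wj → ∧-intro Wj (dec-true (j Finₚ.<? x) j<x)))
                                 (≤-trans (m≤n+m _ (𝟙 (above W x j))) (m≤m+n _ _))

  -- Each vertex j of W above x ∈ W gives the edge xj of K_W, which starts at x.
  edges-up : ∀ W x → W x ≡ true → size (above W x) ≤ count ((inside W ∩ has x) ∩ starts-at x) edges
  edges-up W x Wx = begin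
    size (above W x)                                       ≡⟨ sym (sum-δ-row x (𝟙 ∘ above W x)) ⟩
    sum (λ i → sum (λ j → 𝟙 (eqF x i) * 𝟙 (above W x j))) ≤⟨ sum-mono (λ i → sum-mono (pair i)) ⟩
    sum (λ i → sum (λ j → countMaybe Q (mkEdge i j)))      ≡⟨ sym (count-pairs Q) ⟩
    count Q edges                                          ∎
    where
    open ≤-Reasoning
    Q : Edge → Bool
    Q = (inside W ∩ has x) ∩ starts-at x
    -- At (x , j) with x < j the listed edge xj lies in Q; at every other pair the left side is 0.
    pair : ∀ i j → 𝟙 (eqF x i) * 𝟙 (above W x j) ≤ countMaybe Q (mkEdge i j)
    pair i j with mkEdge i j | mkEdge-view i j
    ... | _ | ordered q = 𝟙-*-≤ λ x≡i Wj∧x<j →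
            ∧-intro (∧-intro (∧-intro (subst (λ k → W k ≡ true) (eqF-true x≡i) Wx) (∧-conicalˡ _ _ Wj∧x<j))
                             (∨-introˡ (eqF x j) x≡i)) x≡i
    ... | _ | unordered ¬i<j = 𝟙-*-≤ λ x≡i Wj∧x<j →
            ⊥-elim (¬i<j (subst (_<ᶠ j) (eqF-true x≡i) (does-true (x Finₚ.<? j) (∧-conicalʳ _ _ Wj∧x<j))))

  -- Each vertex i of W below x ∈ W gives the edge ix of K_W, which does not start at x.
  edges-down : ∀ W x → W x ≡ true → size (below W x) ≤ count ((inside W ∩ has x) ∩ ∁ (starts-at x)) edges
  edges-down W x Wx = begin
    size (below W x)                                       ≡⟨ sym (sum-δ-col x (𝟙 ∘ below W x)) ⟩
    sum (λ i → sum (λ j → 𝟙 (below W x i) * 𝟙 (eqF x j))) ≤⟨ sum-mono (λ i → sum-mono (pair i)) ⟩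
    sum (λ i → sum (λ j → countMaybe Q (mkEdge i j)))      ≡⟨ sym (count-pairs Q) ⟩
    count Q edges                                          ∎
    where
    open ≤-Reasoning
    Q : Edge → Bool
    Q = (inside W ∩ has x) ∩ ∁ (starts-at x)
    -- At (i , x) with i < x the listed edge ix lies in Q; at every other pair the left side is 0.
    pair : ∀ i j → 𝟙 (below W x i) * 𝟙 (eqF x j) ≤ countMaybe Q (mkEdge i j)
    pair i j with mkEdge i j | mkEdge-view i j
    ... | _ | ordered q = 𝟙-*-≤ λ Wi∧i<x x≡j →
            ∧-intro (∧-intro (∧-intro (∧-conicalˡ _ _ Wi∧i<x) (subst (λ k → W k ≡ true) (eqF-true x≡j) Wx))
                             (∨-introʳ (eqF x i) x≡j))
                    (not-intro (eqF-false λ x≡i → Finₚ.<-irrefl (trans (sym x≡i) (eqF-true x≡j)) q))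
    ... | _ | unordered ¬i<j = 𝟙-*-≤ {below W x i} {c = false} λ Wi∧i<x x≡j →
            ⊥-elim (¬i<j (subst (i <ᶠ_) (eqF-true x≡j) (does-true (i Finₚ.<? x) (∧-conicalʳ _ _ Wi∧i<x))))

  -- A vertex x ∈ W is joined inside W to each of the other |W| - 1 vertices.
  degree-bound : ∀ W x → W x ≡ true → size W ≤ suc (count (inside W ∩ has x) edges)
  degree-bound W x Wx = begin
    size W                                                  ≤⟨ size-around W x ⟩
    size (above W x) + size (below W x) + 1                 ≤⟨ +-monoˡ-≤ 1 (+-mono-≤ (edges-up W x Wx) (edges-down W x Wx)) ⟩
    count (Q ∩ first) edges + count (Q ∩ ∁ first) edges + 1 ≡⟨ cong (_+ 1) (sym (count-split Q first edges)) ⟩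
    count Q edges + 1                                       ≡⟨ +-comm (count Q edges) 1 ⟩
    suc (count Q edges)                                     ∎
    where
    open ≤-Reasoning
    Q first : Edge → Bool
    Q     = inside W ∩ has x
    first = starts-at x

  size-delete : ∀ W x → size W ≤ suc (size (W ─ x))
  size-delete W x = begin
    size W                                    ≤⟨ sum-mono at ⟩
    sum (λ i → 𝟙 ((W ─ x) i) + 𝟙 (eqF x i))   ≡⟨ ∑-distrib-+ (λ i → 𝟙 ((W ─ x) i)) _ ⟩
    size (W ─ x) + sum (λ i → 𝟙 (eqF x i))    ≡⟨ cong (size (W ─ x) +_) (sum-δ x) ⟩
    size (W ─ x) + 1                          ≡⟨ +-comm (size (W ─ x)) 1 ⟩
    suc (size (W ─ x))                        ∎
    where
    open ≤-Reasoning
    at : ∀ i → 𝟙 (W i) ≤ 𝟙 ((W ─ x) i) + 𝟙 (eqF x i)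
    at i with W i | eqF x i
    ... | false | _     = z≤n
    ... | true  | false = ≤-refl
    ... | true  | true  = ≤-refl

  inside-delete : ∀ W x e → inside (W ─ x) e ≡ (inside W ∩ ∁ (has x)) e
  inside-delete W x ((i , j) , _) = regroup (W i) (W j) (eqF x i) (eqF x j)
    where
    regroup : ∀ a b c d → (a ∧ not c) ∧ (b ∧ not d) ≡ (a ∧ b) ∧ not (c ∨ d)
    regroup false _ _     _ = refl
    regroup true  b true  _ = sym (∧-zeroʳ b)
    regroup true  _ false _ = refl

  inside-delete⁻ : ∀ W x e → inside (W ─ x) e ≡ true → inside W e ≡ true × has x e ≡ false
  inside-delete⁻ W x e h with trans (sym (inside-delete W x e)) h
  ... | both = ∧-conicalˡ _ _ both , not-elim (∧-conicalʳ _ _ both)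

  inside-delete⁺ : ∀ W x e → inside W e ≡ true → has x e ≡ false → inside (W ─ x) e ≡ true
  inside-delete⁺ W x e in-W x∉e = trans (inside-delete W x e) (∧-intro in-W (not-intro x∉e))

  adj-endpoints : ∀ u v q f → adj ((u , v) , q) f ≡ true → (has u ∪ has v) f ≡ true
  adj-endpoints u v q ((k , l) , _) h = trans (∨-assoc (eqF u k) (eqF u l) _) (∧-conicalʳ _ _ h)

  -- An edge uv has at most two neighbours through a vertex x outside it: xu and xv.
  neighbours-through : ∀ u v q x → has x ((u , v) , q) ≡ false → count (adj ((u , v) , q) ∩ has x) edges ≤ 2
  neighbours-through u v q x x∉e = begin
    count (adj e ∩ has x) edges                               ≤⟨ count-mono via-endpoint edges ⟩
    count ((has u ∩ has x) ∪ (has v ∩ has x)) edges           ≤⟨ count-∪ (has u ∩ has x) _ edges ⟩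
    count (has u ∩ has x) edges + count (has v ∩ has x) edges ≤⟨ +-mono-≤ (common-edge u x x≢u) (common-edge v x x≢v) ⟩
    2                                                         ∎
    where
    open ≤-Reasoning
    e : Edge
    e = (u , v) , q
    x≢u : ¬ x ≡ u
    x≢u = eqF-false⇒≢ (Boolₚ.∨-conicalˡ (eqF x u) (eqF x v) x∉e)
    x≢v : ¬ x ≡ v
    x≢v = eqF-false⇒≢ (Boolₚ.∨-conicalʳ (eqF x u) (eqF x v) x∉e)
    via-endpoint : adj e ∩ has x ⊆ (has u ∩ has x) ∪ (has v ∩ has x)
    via-endpoint f h with ∩-elim (adj e) (has x) f h
    ... | adj-ef , x∈f with ∨-true (adj-endpoints u v q f adj-ef)
    ...   | inj₁ u∈f = ∨-introˡ (has v f ∧ has x f) (∧-intro u∈f x∈f)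
    ...   | inj₂ v∈f = ∨-introʳ (has u f ∧ has x f) (∧-intro v∈f x∈f)

  infected : (Edge → Bool) → Vertices → ℕ
  infected A W = count (A ∩ inside W) edges

  -- Threshold-s percolation of A inside L(K_W) implies the following spreading property:
  -- every nonempty set X of uninfected edges of K_W has a member with at least s neighbours
  -- in K_W outside X; otherwise no edge of X could ever become infected.
  Spreading : ℕ → Vertices → (Edge → Bool) → Set
  Spreading s W A = ∀ (X : Edge → Bool) → X ⊆ inside W ∩ ∁ A → (∃ λ e → X e ≡ true) →
                    ∃ λ e → X e ≡ true × s ≤ count (adj e ∩ inside W ∩ ∁ X) edges

  -- A set X of initially uninfected edges, each with fewer than r neighbours outside X,
  -- is never infected: by induction on the round, the infected neighbours of an edge of X
  -- all lie outside X.
  closed-stays-uninfected : ∀ r A X → X ⊆ ∁ A → (∀ e → X e ≡ true → ¬ r ≤ count (adj e ∩ ∁ X) edges) →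
                            ∀ i e → X e ≡ true → iter (LK n) r i A e ≡ false
  closed-stays-uninfected r A X X-fresh closed zero    e Xe = not-elim (X-fresh e Xe)
  closed-stays-uninfected r A X X-fresh closed (suc i) e Xe
    rewrite closed-stays-uninfected r A X X-fresh closed i e Xe =
    dec-false (T? (r ≤ᵇ _)) λ r≤ → closed e Xe (≤-trans (≤ᵇ⇒≤ r _ r≤) (count-mono infected⇒outside edges))
    where
    stays : ∀ i e → X e ≡ true → iter (LK n) r i A e ≡ false
    stays = closed-stays-uninfected r A X X-fresh closed
    infected⇒outside : adj e ∩ iter (LK n) r i A ⊆ adj e ∩ ∁ X
    infected⇒outside f h with X f in Xf
    ... | true  = ⊥-elim (Boolₚ.not-¬ (stays i f Xf) (∧-conicalʳ _ _ h))
    ... | false = ∧-intro (∧-conicalˡ _ _ h) refl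

  percolating⇒spreading : ∀ r A → Percolating (LK n) r A → Spreading r everything A
  percolating⇒spreading r A percolates X X-fresh (e₀ , Xe₀)
    with any? (λ e → (X e Boolₚ.≟ true) ×-dec (r ≤? count (adj e ∩ ∁ X) edges)) edges
  ... | yes found = satisfied found
  ... | no none with percolates e₀
  ...   | i , infected-e₀ =
    ⊥-elim (Boolₚ.not-¬ (closed-stays-uninfected r A X X-fresh closed i e₀ Xe₀) infected-e₀)
    where
    closed : ∀ e → X e ≡ true → ¬ r ≤ count (adj e ∩ ∁ X) edges
    closed e Xe r≤ = none (lose (every-edge-listed e) (Xe , r≤))

  fresh-delete : ∀ W A x → inside (W ─ x) ∩ ∁ A ⊆ inside W ∩ ∁ A
  fresh-delete W A x f h with ∩-elim (inside (W ─ x)) (∁ A) f h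
  ... | in-W-x , A∌f = ∧-intro (proj₁ (inside-delete⁻ W x f in-W-x)) A∌f

  -- Deleting a vertex x costs at most 2 in the threshold: an edge of K_{W-x} loses at most
  -- its two neighbours through x.
  spreading-delete : ∀ s W A x → Spreading (2 + s) W A → Spreading s (W ─ x) A
  spreading-delete s W A x spreads X X-fresh nonempty
    with spreads X (λ f Xf → fresh-delete W A x f (X-fresh f Xf)) nonempty
  ... | e@((u , v) , q) , Xe , many = e , Xe , +-cancelˡ-≤ 2 s _ (begin
      2 + s                                                 ≤⟨ many ⟩
      count N edges                                         ≡⟨ count-split N (has x) edges ⟩
      count (N ∩ has x) edges + count (N ∩ ∁ (has x)) edges ≤⟨ +-mono-≤ through-x (count-mono avoiding-x edges) ⟩
      2 + count (adj e ∩ inside (W ─ x) ∩ ∁ X) edges        ∎)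
    where
    open ≤-Reasoning
    N : Edge → Bool
    N = adj e ∩ inside W ∩ ∁ X
    x∉e : has x e ≡ false
    x∉e = proj₂ (inside-delete⁻ W x e (proj₁ (∩-elim (inside (W ─ x)) (∁ A) e (X-fresh e Xe))))
    forget-W : N ∩ has x ⊆ adj e ∩ has x
    forget-W f h with ∩-elim N (has x) f h
    ... | Nf , x∈f = ∧-intro (proj₁ (∩-elim (adj e) (inside W ∩ ∁ X) f Nf)) x∈f
    through-x : count (N ∩ has x) edges ≤ 2
    through-x = ≤-trans (count-mono forget-W edges) (neighbours-through u v q x x∉e)
    avoiding-x : N ∩ ∁ (has x) ⊆ adj e ∩ inside (W ─ x) ∩ ∁ X
    avoiding-x f h with ∩-elim N (∁ (has x)) f h
    ... | Nf , x∉f with ∩-elim (adj e) (inside W ∩ ∁ X) f Nf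
    ...   | adj-ef , rest with ∩-elim (inside W) (∁ X) f rest
    ...     | in-W , X∌f = ∧-intro adj-ef (∧-intro (inside-delete⁺ W x f in-W (not-elim x∉f)) X∌f)

  -- If every edge of K_W is infected, the edges of K_W at x and the edges of K_{W-x}
  -- are two disjoint parts of A ∩ E(K_W).
  full-split : ∀ W A x → inside W ⊆ A →
               count (inside W ∩ has x) edges + infected A (W ─ x) ≤ infected A W
  full-split W A x full = begin
    count (inside W ∩ has x) edges + infected A (W ─ x) ≤⟨ +-mono-≤ (count-mono at-x edges) (count-mono off-x edges) ⟩
    count (S ∩ has x) edges + count (S ∩ ∁ (has x)) edges ≡⟨ sym (count-split S (has x) edges) ⟩
    infected A W                                          ∎
    where
    open ≤-Reasoning
    S : Edge → Bool
    S = A ∩ inside W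
    at-x : inside W ∩ has x ⊆ S ∩ has x
    at-x f h with ∩-elim (inside W) (has x) f h
    ... | in-W , x∈f = ∧-intro (∧-intro (full f in-W) in-W) x∈f
    off-x : A ∩ inside (W ─ x) ⊆ S ∩ ∁ (has x)
    off-x f h with ∩-elim A (inside (W ─ x)) f h
    ... | Af , in-W-x with inside-delete⁻ W x f in-W-x
    ...   | in-W , x∉f = ∧-intro (∧-intro Af in-W) (not-intro x∉f)

  -- The infected neighbours of an edge uv inside K_W, and the infected edges of K_{W-u-v},
  -- are disjoint parts of A ∩ E(K_W): split the former by whether they contain u.
  edge-split : ∀ W A u v q →
               count (adj ((u , v) , q) ∩ A ∩ inside W) edges + infected A ((W ─ u) ─ v) ≤ infected A W
  edge-split W A u v q = begin
    count M edges + infected A ((W ─ u) ─ v)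
      ≡⟨ cong (_+ infected A ((W ─ u) ─ v)) (count-split M (has u) edges) ⟩
    count (M ∩ has u) edges + count (M ∩ ∁ (has u)) edges + infected A ((W ─ u) ─ v)
      ≤⟨ +-mono-≤ (+-mono-≤ (count-mono at-u edges) (count-mono at-v edges)) (count-mono off-uv edges) ⟩
    count (S ∩ has u) edges + count (S′ ∩ has v) edges + count (S′ ∩ ∁ (has v)) edges
      ≡⟨ +-assoc (count (S ∩ has u) edges) _ _ ⟩
    count (S ∩ has u) edges + (count (S′ ∩ has v) edges + count (S′ ∩ ∁ (has v)) edges)
      ≡⟨ cong (count (S ∩ has u) edges +_) (sym (count-split S′ (has v) edges)) ⟩
    count (S ∩ has u) edges + count S′ edges
      ≡⟨ sym (count-split S (has u) edges) ⟩
    infected A W ∎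
    where
    open ≤-Reasoning
    e : Edge
    e = (u , v) , q
    S S′ M : Edge → Bool
    S  = A ∩ inside W
    S′ = S ∩ ∁ (has u)
    M  = adj e ∩ S
    at-u : M ∩ has u ⊆ S ∩ has u
    at-u f h with ∩-elim M (has u) f h
    ... | Mf , u∈f = ∧-intro (proj₂ (∩-elim (adj e) S f Mf)) u∈f
    at-v : M ∩ ∁ (has u) ⊆ S′ ∩ has v
    at-v f h with ∩-elim M (∁ (has u)) f h
    ... | Mf , u∉f with ∩-elim (adj e) S f Mf
    ...   | adj-ef , Sf with ∨-true (adj-endpoints u v q f adj-ef)
    ...     | inj₁ u∈f = ⊥-elim (Boolₚ.not-¬ u∈f (not-elim u∉f))
    ...     | inj₂ v∈f = ∧-intro (∧-intro Sf u∉f) v∈f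
    off-uv : A ∩ inside ((W ─ u) ─ v) ⊆ S′ ∩ ∁ (has v)
    off-uv f h with ∩-elim A (inside ((W ─ u) ─ v)) f h
    ... | Af , in-W-u-v with inside-delete⁻ (W ─ u) v f in-W-u-v
    ...   | in-W-u , v∉f with inside-delete⁻ W u f in-W-u
    ...     | in-W , u∉f = ∧-intro (∧-intro (∧-intro Af in-W) (not-intro u∉f)) (not-intro v∉f)

  full-or-fresh : ∀ W A → inside W ⊆ A ⊎ ∃ λ e → (inside W ∩ ∁ A) e ≡ true
  full-or-fresh W A with any? (λ e → (inside W ∩ ∁ A) e Boolₚ.≟ true) edges
  ... | yes found = inj₂ (satisfied found)
  ... | no none = inj₁ full
    where
    full : inside W ⊆ A
    full e in-W with A e in Ae
    ... | true  = refl
    ... | false = ⊥-elim (none (lose (every-edge-listed e) (∧-intro in-W (not-intro Ae))))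

  -- If some edge of K_W is uninfected, the spreading property applied to all uninfected
  -- edges of K_W gives one with s infected neighbours inside K_W.
  busy-edge : ∀ s W A → Spreading s W A → (∃ λ e → (inside W ∩ ∁ A) e ≡ true) →
              ∃ λ e → s ≤ count (adj e ∩ A ∩ inside W) edges
  busy-edge s W A spreads fresh with spreads (inside W ∩ ∁ A) (λ _ h → h) fresh
  ... | e , _ , many = e , ≤-trans many (count-mono outside⇒infected edges)
    where
    outside⇒infected : adj e ∩ inside W ∩ ∁ (inside W ∩ ∁ A) ⊆ adj e ∩ A ∩ inside W
    outside⇒infected f h with ∩-elim (adj e) (inside W ∩ ∁ (inside W ∩ ∁ A)) f h
    ... | adj-ef , rest with ∩-elim (inside W) (∁ (inside W ∩ ∁ A)) f rest
    ...   | in-W , not-fresh = ∧-intro adj-ef (∧-intro (infected-if in-W not-fresh) in-W)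
      where
      infected-if : inside W f ≡ true → not (inside W f ∧ not (A f)) ≡ true → A f ≡ true
      infected-if w nf rewrite w = trans (sym (Boolₚ.not-involutive (A f))) nf

  InfectedBound : ℕ → Set
  InfectedBound s = ∀ W A → 2 + ⌈ s /2⌉ ≤ size W → Spreading s W A → bound s ≤ infected A W

  -- Thresholds s ≤ 3: bound s ≤ s, and s infected edges are found either at a vertex of a
  -- fully infected K_W or around an uninfected edge chosen by the spreading property.
  small-threshold : ∀ s → s ≤ 3 → InfectedBound s
  small-threshold s s≤3 W A large spreads = ≤-trans (bound-small s s≤3) (enough (full-or-fresh W A))
    where
    enough : inside W ⊆ A ⊎ (∃ λ e → (inside W ∩ ∁ A) e ≡ true) → s ≤ infected A W
    enough (inj₁ full) with sum-witness W (≤-trans (s≤s z≤n) large)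
    ... | x , Wx = begin
      s                                                   ≤⟨ small-half s s≤3 ⟩
      1 + ⌈ s /2⌉                                         ≤⟨ ≤-pred (≤-trans large (degree-bound W x Wx)) ⟩
      count (inside W ∩ has x) edges                      ≤⟨ m≤m+n _ _ ⟩
      count (inside W ∩ has x) edges + infected A (W ─ x) ≤⟨ full-split W A x full ⟩
      infected A W                                        ∎
      where open ≤-Reasoning
    enough (inj₂ fresh) with busy-edge s W A spreads fresh
    ... | ((u , v) , q) , many = ≤-trans many (≤-trans (m≤m+n _ _) (edge-split W A u v q))

  -- The inductive step from t and t + 2 to t + 4.  If every edge of K_W is infected, delete a
  -- vertex x: it carries |W| - 1 infected edges.  Otherwise take an uninfected edge uv with
  -- t + 4 infected neighbours and delete u and v.
  inductive-step : ∀ t → InfectedBound t → InfectedBound (2 + t) → InfectedBound (4 + t)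
  inductive-step t IH IH₂ W A large spreads with full-or-fresh W A
  ... | inj₁ full with sum-witness W (≤-trans (s≤s z≤n) large)
  ...   | x , Wx = begin
    bound (4 + t)                                       ≤⟨ bound-step2 (2 + t) ⟩
    bound (2 + t) + (2 + ⌈ 2 + t /2⌉)                   ≤⟨ +-mono-≤ (IH₂ (W ─ x) A large-x spreads-x) degree ⟩
    infected A (W ─ x) + count (inside W ∩ has x) edges ≡⟨ +-comm (infected A (W ─ x)) _ ⟩
    count (inside W ∩ has x) edges + infected A (W ─ x) ≤⟨ full-split W A x full ⟩
    infected A W                                        ∎
    where
    open ≤-Reasoning
    large-x : 2 + ⌈ 2 + t /2⌉ ≤ size (W ─ x)
    large-x = ≤-pred (≤-trans large (size-delete W x))
    spreads-x : Spreading (2 + t) (W ─ x) A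
    spreads-x = spreading-delete (2 + t) W A x spreads
    degree : 2 + ⌈ 2 + t /2⌉ ≤ count (inside W ∩ has x) edges
    degree = ≤-pred (≤-trans large (degree-bound W x Wx))
  inductive-step t IH IH₂ W A large spreads | inj₂ fresh with busy-edge (4 + t) W A spreads fresh
  ... | ((u , v) , q) , many = begin
    bound (4 + t)                                         ≡⟨ bound-step4 t ⟩
    bound t + (4 + t)                                     ≤⟨ +-mono-≤ (IH W-u-v A large-uv spreads-uv) many ⟩
    infected A W-u-v + count (adj e ∩ A ∩ inside W) edges ≡⟨ +-comm (infected A W-u-v) _ ⟩
    count (adj e ∩ A ∩ inside W) edges + infected A W-u-v ≤⟨ edge-split W A u v q ⟩
    infected A W                                          ∎
    where
    open ≤-Reasoning
    e : Edge
    e = (u , v) , q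
    W-u-v : Vertices
    W-u-v = (W ─ u) ─ v
    large-uv : 2 + ⌈ t /2⌉ ≤ size W-u-v
    large-uv = ≤-pred (≤-pred (≤-trans large (≤-trans (size-delete W u) (s≤s (size-delete (W ─ u) v)))))
    spreads-uv : Spreading t W-u-v A
    spreads-uv = spreading-delete t (W ─ u) A v (spreading-delete (2 + t) W A u spreads)

  infected-bound : ∀ s → InfectedBound s
  infected-bound 0 = small-threshold 0 z≤n
  infected-bound 1 = small-threshold 1 (s≤s z≤n)
  infected-bound 2 = small-threshold 2 (s≤s (s≤s z≤n))
  infected-bound 3 = small-threshold 3 (s≤s (s≤s (s≤s z≤n)))
  infected-bound (suc (suc (suc (suc t)))) =
    inductive-step t (infected-bound t) (infected-bound (suc (suc t)))

lemma5p3 : (n r : ℕ) → n ≥ ⌈ r /2⌉ + 2 →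
    (A : VSet (LK n)) → Percolating (LK n) r A →
    card (LK n) A ≥ ((r + 2) * (r + 2)) / 8
lemma5p3 n r n-large A percolates = begin
  bound r               ≤⟨ infected-bound r everything A large (percolating⇒spreading r A percolates) ⟩
  infected A everything ≤⟨ count-mono (λ e h → proj₁ (∩-elim A (inside everything) e h)) edges ⟩
  count A edges         ∎
  where
  open CompleteGraph n
  open ≤-Reasoning
  large : 2 + ⌈ r /2⌉ ≤ size everything
  large = subst₂ _≤_ (+-comm ⌈ r /2⌉ 2) (sym (sum-ones n)) n-large
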